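{- Let $A$ be an $n\times m$ binary matrix with $R_{binary}(A)=n$. Then $A$ has the Augmentation property for the binary rank.
   Context: A binary matrix has entries in $\{0,1\}$. $R_{binary}(A)$ is the minimal $k$ with $A=U\cdot V$, $U$ an $n\times k$ and $V$ a $k\times m$ binary matrix, using ordinary integer arithmetic. $A$ has the Augmentation property for the binary rank if for any binary column vectors $x_1,\dots,x_t$ with $R_{binary}(A|x_i)=R_{binary}(A)$ for all $i$, also $R_{binary}(A|x_1,\dots,x_t)=R_{binary}(A)$, where $(A|x_1,\dots,x_t)$ is $A$ with the columns $x_1,\dots,x_t$ appended. -}

module Defs where

open import Data.Nat using (ℕ; _*_; _<_)
open import Data.Fin using (Fin; splitAt)
open import Data.Sum using ([_,_]′)
open import Data.Product using (Σ; _×_; ∃)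
open import Data.Vec.Functional using (Vector; foldr)
open import Data.Nat using (_+_)
open import Relation.Binary.PropositionalEquality using (_≡_)
open import Relation.Nullary using (¬_)
open import Data.Sum using (_⊎_)

-- An n × m matrix with natural-number entries (ordinary integer arithmetic;
-- binary matrices have entries in {0,1} ⊆ ℕ, products are computed over ℕ).
Matrix : ℕ → ℕ → Set
Matrix n m = Fin n → Fin m → ℕ

Column : ℕ → Set
Column n = Fin n → ℕ

IsBit : ℕ → Set
IsBit x = (x ≡ 0) ⊎ (x ≡ 1)

IsBinary : ∀ {n m} → Matrix n m → Set
IsBinary {n} {m} A = ∀ (i : Fin n) (j : Fin m) → IsBit (A i j)

IsBinaryColumn : ∀ {n} → Column n → Set
IsBinaryColumn {n} x = ∀ (i : Fin n) → IsBit (x i)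

sumFin : ∀ {k} → (Fin k → ℕ) → ℕ
sumFin f = foldr _+_ 0 f

_·_ : ∀ {n k m} → Matrix n k → Matrix k m → Matrix n m
(U · V) i j = sumFin (λ l → U i l * V l j)

HasBinaryFactorization : ∀ {n m} → Matrix n m → ℕ → Set
HasBinaryFactorization {n} {m} A k =
  Σ (Matrix n k) λ U → Σ (Matrix k m) λ V →
    IsBinary U × IsBinary V × (∀ i j → A i j ≡ (U · V) i j)

BinaryRankIs : ∀ {n m} → Matrix n m → ℕ → Set
BinaryRankIs A r =
  HasBinaryFactorization A r × (∀ k → k < r → ¬ HasBinaryFactorization A k)

appendCols : ∀ {n m t} → Matrix n m → (Fin t → Column n) → Matrix n (m + t)
appendCols {m = m} A X i j = [ (λ j₁ → A i j₁) , (λ l → X l i) ]′ (splitAt m j)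

appendCol : ∀ {n m} → Matrix n m → Column n → Matrix n (m + 1)
appendCol A x = appendCols A (λ _ → x)

AugmentationProperty : ∀ {n m} → Matrix n m → Set
AugmentationProperty {n} A =
  ∀ (r : ℕ) → BinaryRankIs A r →
  ∀ (t : ℕ) (X : Fin t → Column n) →
    (∀ l → IsBinaryColumn (X l)) →
    (∀ l → BinaryRankIs (appendCol A (X l)) r) →
    BinaryRankIs (appendCols A X) r

-- A binary matrix with n rows always factors as I_n · A, so its binary rank is at
-- most n; and a binary factorization of (A | X) restricts to one of A by dropping
-- the appended columns of the right factor, so appending columns never lowers the
-- binary rank. Hence full row rank n is preserved by appending any binary columns,
-- whatever the ranks of the single augmentations (A | x_i) are.
module Submission where

open import Defs
open import Data.Nat using (ℕ; zero; suc; _+_)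
open import Data.Nat.Properties using (+-identityʳ; <-cmp)
open import Data.Fin using (Fin; zero; suc; splitAt; _↑ˡ_)
open import Data.Fin.Properties using (splitAt-↑ˡ)
open import Data.Sum using (inj₁; inj₂)
open import Data.Product using (_,_)
open import Data.Empty using (⊥-elim)
open import Relation.Binary using (tri<; tri≈; tri>)
open import Relation.Binary.PropositionalEquality using (_≡_; refl; sym; trans; cong; subst)

identityMatrix : ∀ {n} → Matrix n n
identityMatrix zero    zero    = 1
identityMatrix zero    (suc _) = 0
identityMatrix (suc _) zero    = 0
identityMatrix (suc i) (suc j) = identityMatrix i j

identityMatrix-binary : ∀ {n} → IsBinary (identityMatrix {n})
identityMatrix-binary zero    zero    = inj₂ refl
identityMatrix-binary zero    (suc _) = inj₁ refl
identityMatrix-binary (suc _) zero    = inj₁ refl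
identityMatrix-binary (suc i) (suc j) = identityMatrix-binary i j

sumFin-zero : ∀ {k} (f : Fin k → ℕ) → (∀ l → f l ≡ 0) → sumFin f ≡ 0
sumFin-zero {zero}  f f≡0 = refl
sumFin-zero {suc k} f f≡0 rewrite f≡0 zero = sumFin-zero (λ l → f (suc l)) (λ l → f≡0 (suc l))

·-identityˡ : ∀ {n m} (M : Matrix n m) i j → (identityMatrix · M) i j ≡ M i j
·-identityˡ {suc n} M zero j =
  trans (cong (λ s → M zero j + 0 + s) (sumFin-zero {n} _ (λ _ → refl)))
        (trans (+-identityʳ _) (+-identityʳ _))
·-identityˡ {suc n} M (suc i) j = ·-identityˡ (λ l → M (suc l)) i j

binaryFactorization-rows : ∀ {n m} {A : Matrix n m} →
  IsBinary A → HasBinaryFactorization A n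
binaryFactorization-rows {A = A} A-bin =
  identityMatrix , A , identityMatrix-binary , A-bin , λ i j → sym (·-identityˡ A i j)

binaryRank-unique : ∀ {n m} {A : Matrix n m} {r s} →
  BinaryRankIs A r → BinaryRankIs A s → r ≡ s
binaryRank-unique {r = r} {s} (fr , minr) (fs , mins) with <-cmp r s
... | tri< r<s _ _ = ⊥-elim (mins r r<s fr)
... | tri≈ _ r≡s _ = r≡s
... | tri> _ _ s<r = ⊥-elim (minr s s<r fs)

appendCols-binary : ∀ {n m t} {A : Matrix n m} {X : Fin t → Column n} →
  IsBinary A → (∀ l → IsBinaryColumn (X l)) → IsBinary (appendCols A X)
appendCols-binary {m = m} A-bin X-bin i j with splitAt m j
... | inj₁ j₁ = A-bin i j₁
... | inj₂ l  = X-bin l i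

appendCols-↑ˡ : ∀ {n m t} (A : Matrix n m) (X : Fin t → Column n) i j →
  appendCols A X i (j ↑ˡ t) ≡ A i j
appendCols-↑ˡ {m = m} {t} A X i j rewrite splitAt-↑ˡ m j t = refl

binaryFactorization-appendCols⇒ : ∀ {n m t k} {A : Matrix n m} {X : Fin t → Column n} →
  HasBinaryFactorization (appendCols A X) k → HasBinaryFactorization A k
binaryFactorization-appendCols⇒ {t = t} {A = A} {X} (U , V , U-bin , V-bin , A|X≡UV) =
  U , (λ l j → V l (j ↑ˡ t)) , U-bin , (λ l j → V-bin l (j ↑ˡ t)) ,
  λ i j → trans (sym (appendCols-↑ˡ A X i j)) (A|X≡UV i (j ↑ˡ t))

binaryRank-appendCols-full : ∀ {n m t} {A : Matrix n m} {X : Fin t → Column n} →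
  IsBinary A → (∀ l → IsBinaryColumn (X l)) →
  BinaryRankIs A n → BinaryRankIs (appendCols A X) n
binaryRank-appendCols-full A-bin X-bin (_ , minA) =
  binaryFactorization-rows (appendCols-binary A-bin X-bin) ,
  λ k k<n fact → minA k k<n (binaryFactorization-appendCols⇒ fact)

mainTheorem14 : ∀ (n m : ℕ) (A : Matrix n m) →
    IsBinary A → BinaryRankIs A n → AugmentationProperty A
mainTheorem14 n m A A-bin rankA≡n r rankA≡r t X X-bin _ =
  subst (BinaryRankIs (appendCols A X)) (binaryRank-unique rankA≡n rankA≡r)
        (binaryRank-appendCols-full A-bin X-bin rankA≡n)
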